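{- For every integer $n \geq 3$, the graph $C_4 \times K_n$ admits a $C_4$-decomposition.
   Context: $K_n$ is the complete graph on $n$ vertices, $C_k$ the cycle of length $k$. The tensor product $G \times H$ has vertex set $V(G)\times V(H)$, with $(g_1,h_1)$ adjacent to $(g_2,h_2)$ iff $g_1g_2 \in E(G)$ and $h_1h_2 \in E(H)$. A $C_k$-decomposition of a graph is a partition of its edge set into edge sets of subgraphs isomorphic to $C_k$. -}

module Defs where

open import Level using (Level; suc; _⊔_)
open import Data.Nat using (ℕ; _%_; NonZero) renaming (suc to sucℕ)
open import Data.Fin using (Fin; toℕ)
open import Data.Product using (_×_; _,_; Σ; ∃)
open import Data.Sum using (_⊎_)
open import Relation.Binary.PropositionalEquality using (_≡_; _≢_)

record Graph : Set₁ where
  field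
    V : Set
    E : V → V → Set
open Graph public

K : ℕ → Graph
K n = record { V = Fin n ; E = λ i j → i ≢ j }

C : (k : ℕ) → .{{NonZero k}} → Graph
C k = record { V = Fin k
             ; E = λ i j → (toℕ j ≡ sucℕ (toℕ i) % k) ⊎ (toℕ i ≡ sucℕ (toℕ j) % k) }

-- Tensor (categorical) product G × H.
_⊗_ : Graph → Graph → Graph
G ⊗ H = record { V = V G × V H
               ; E = λ { (g₁ , h₁) (g₂ , h₂) → E G g₁ g₂ × E H h₁ h₂ } }

record FourCycle (G : Graph) : Set where
  field
    v₀ v₁ v₂ v₃ : V G
    d₀₁ : v₀ ≢ v₁
    d₀₂ : v₀ ≢ v₂
    d₀₃ : v₀ ≢ v₃
    d₁₂ : v₁ ≢ v₂
    d₁₃ : v₁ ≢ v₃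
    d₂₃ : v₂ ≢ v₃
    e₀₁ : E G v₀ v₁
    e₁₂ : E G v₁ v₂
    e₂₃ : E G v₂ v₃
    e₃₀ : E G v₃ v₀
open FourCycle public

EdgeOf : {G : Graph} → FourCycle G → V G → V G → Set
EdgeOf c u v =
    ((u ≡ v₀ c × v ≡ v₁ c) ⊎ (u ≡ v₁ c × v ≡ v₀ c))
  ⊎ ((u ≡ v₁ c × v ≡ v₂ c) ⊎ (u ≡ v₂ c × v ≡ v₁ c))
  ⊎ ((u ≡ v₂ c × v ≡ v₃ c) ⊎ (u ≡ v₃ c × v ≡ v₂ c))
  ⊎ ((u ≡ v₃ c × v ≡ v₀ c) ⊎ (u ≡ v₀ c × v ≡ v₃ c))

-- A C_4-decomposition of G: a finite family of 4-cycle subgraphs of G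
-- such that every edge of G lies in exactly one member of the family.
-- (Each cycle's edges are edges of G by construction, so this is a
-- partition of E(G).)
C4Decomposition : Graph → Set
C4Decomposition G =
  Σ ℕ λ m → Σ (Fin m → FourCycle G) λ cs →
    ∀ u v → E G u v →
      Σ (Fin m) λ i → EdgeOf (cs i) u v × (∀ j → EdgeOf (cs j) u v → j ≡ i)

-- Every arc (x, y) of a graph H (an ordered pair with xy ∈ E(H)) gives the
-- 4-cycle (0,x) (1,y) (2,x) (3,y) of C₄ × H, carrying x on the even layers of
-- C₄ and y on the odd ones. An edge {(a,s), (b,t)} of C₄ × H joins an even
-- and an odd layer, so it lies in the cycle of the arc running from its
-- even-layer value to its odd-layer value, and in no other. Hence any
-- enumeration of the arcs of H indexes a C₄-decomposition of C₄ × H; for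
-- H = K_n the arcs are enumerated by Fin n × Fin (n - 1) via punchIn.
module Submission where

open import Defs
open import Data.Nat using (ℕ; _≥_; zero; suc; _*_)
open import Data.Fin using (Fin; zero; suc; punchIn; punchOut; combine; remQuot)
open import Data.Fin.Properties
  using (punchInᵢ≢i; punchIn-punchOut; punchIn-injective; remQuot-combine; combine-remQuot)
open import Data.Product using (_×_; _,_; Σ; proj₁; proj₂; uncurry)
open import Data.Sum using (inj₁; inj₂)
open import Function using (_∘_)
open import Relation.Binary.PropositionalEquality

alternate : {A : Set} → Fin 4 → A → A → A
alternate zero                   x y = x
alternate (suc zero)             x y = y
alternate (suc (suc zero))       x y = x
alternate (suc (suc (suc zero))) x y = y

record ArcEnumeration (H : Graph) : Set where
  field
    size      : ℕ
    arc       : Fin size → V H × V H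
    arc-edge  : ∀ j → E H (proj₁ (arc j)) (proj₂ (arc j))
    index     : ∀ {x y} → E H x y → Fin size
    arc-index : ∀ {x y} (e : E H x y) → arc (index e) ≡ (x , y)
    index-arc : ∀ {x y} (e : E H x y) j → arc j ≡ (x , y) → j ≡ index e

module _ {H : Graph} (E-sym : ∀ {x y} → E H x y → E H y x) where

  alternatingCycle : ∀ {x y} → E H x y → FourCycle (C 4 ⊗ H)
  alternatingCycle {x} {y} e = record
    { v₀ = zero , x ; v₁ = suc zero , y ; v₂ = suc (suc zero) , x ; v₃ = suc (suc (suc zero)) , y
    ; d₀₁ = λ () ; d₀₂ = λ () ; d₀₃ = λ () ; d₁₂ = λ () ; d₁₃ = λ () ; d₂₃ = λ ()
    ; e₀₁ = inj₁ refl , e ; e₁₂ = inj₁ refl , E-sym e ; e₂₃ = inj₁ refl , e ; e₃₀ = inj₁ refl , E-sym e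
    }

  alternate-edge : ∀ a {s t} → E H s t → E H (alternate a s t) (alternate a t s)
  alternate-edge zero                   e = e
  alternate-edge (suc zero)             e = E-sym e
  alternate-edge (suc (suc zero))       e = e
  alternate-edge (suc (suc (suc zero))) e = E-sym e

  alternatingCycle-cong : ∀ {x y x′ y′} (e : E H x y) (e′ : E H x′ y′) {u v} →
                          (x , y) ≡ (x′ , y′) →
                          EdgeOf (alternatingCycle e) u v → EdgeOf (alternatingCycle e′) u v
  alternatingCycle-cong e e′ refl c = c

  edgeOf-alternatingCycle : ∀ a b {s t} (e : E H (alternate a s t) (alternate a t s)) →
                            E (C 4) a b → EdgeOf (alternatingCycle e) (a , s) (b , t)
  edgeOf-alternatingCycle zero                   zero                   e (inj₁ ())
  edgeOf-alternatingCycle zero                   zero                   e (inj₂ ())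
  edgeOf-alternatingCycle zero                   (suc zero)             e _ = inj₁ (inj₁ (refl , refl))
  edgeOf-alternatingCycle zero                   (suc (suc zero))       e (inj₁ ())
  edgeOf-alternatingCycle zero                   (suc (suc zero))       e (inj₂ ())
  edgeOf-alternatingCycle zero                   (suc (suc (suc zero))) e _ = inj₂ (inj₂ (inj₂ (inj₂ (refl , refl))))
  edgeOf-alternatingCycle (suc zero)             zero                   e _ = inj₁ (inj₂ (refl , refl))
  edgeOf-alternatingCycle (suc zero)             (suc zero)             e (inj₁ ())
  edgeOf-alternatingCycle (suc zero)             (suc zero)             e (inj₂ ())
  edgeOf-alternatingCycle (suc zero)             (suc (suc zero))       e _ = inj₂ (inj₁ (inj₁ (refl , refl)))
  edgeOf-alternatingCycle (suc zero)             (suc (suc (suc zero))) e (inj₁ ())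
  edgeOf-alternatingCycle (suc zero)             (suc (suc (suc zero))) e (inj₂ ())
  edgeOf-alternatingCycle (suc (suc zero))       zero                   e (inj₁ ())
  edgeOf-alternatingCycle (suc (suc zero))       zero                   e (inj₂ ())
  edgeOf-alternatingCycle (suc (suc zero))       (suc zero)             e _ = inj₂ (inj₁ (inj₂ (refl , refl)))
  edgeOf-alternatingCycle (suc (suc zero))       (suc (suc zero))       e (inj₁ ())
  edgeOf-alternatingCycle (suc (suc zero))       (suc (suc zero))       e (inj₂ ())
  edgeOf-alternatingCycle (suc (suc zero))       (suc (suc (suc zero))) e _ = inj₂ (inj₂ (inj₁ (inj₁ (refl , refl))))
  edgeOf-alternatingCycle (suc (suc (suc zero))) zero                   e _ = inj₂ (inj₂ (inj₂ (inj₁ (refl , refl))))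
  edgeOf-alternatingCycle (suc (suc (suc zero))) (suc zero)             e (inj₁ ())
  edgeOf-alternatingCycle (suc (suc (suc zero))) (suc zero)             e (inj₂ ())
  edgeOf-alternatingCycle (suc (suc (suc zero))) (suc (suc zero))       e _ = inj₂ (inj₂ (inj₁ (inj₂ (refl , refl))))
  edgeOf-alternatingCycle (suc (suc (suc zero))) (suc (suc (suc zero))) e (inj₁ ())
  edgeOf-alternatingCycle (suc (suc (suc zero))) (suc (suc (suc zero))) e (inj₂ ())

  edgeOf-alternatingCycle⁻¹ : ∀ {x y a b s t} (e : E H x y) →
                              EdgeOf (alternatingCycle e) (a , s) (b , t) →
                              (x , y) ≡ (alternate a s t , alternate a t s)
  edgeOf-alternatingCycle⁻¹ e (inj₁ (inj₁ (refl , refl)))                = refl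
  edgeOf-alternatingCycle⁻¹ e (inj₁ (inj₂ (refl , refl)))                = refl
  edgeOf-alternatingCycle⁻¹ e (inj₂ (inj₁ (inj₁ (refl , refl))))         = refl
  edgeOf-alternatingCycle⁻¹ e (inj₂ (inj₁ (inj₂ (refl , refl))))         = refl
  edgeOf-alternatingCycle⁻¹ e (inj₂ (inj₂ (inj₁ (inj₁ (refl , refl)))))  = refl
  edgeOf-alternatingCycle⁻¹ e (inj₂ (inj₂ (inj₁ (inj₂ (refl , refl)))))  = refl
  edgeOf-alternatingCycle⁻¹ e (inj₂ (inj₂ (inj₂ (inj₁ (refl , refl)))))  = refl
  edgeOf-alternatingCycle⁻¹ e (inj₂ (inj₂ (inj₂ (inj₂ (refl , refl)))))  = refl

  C₄⊗-decomposition : ArcEnumeration H → C4Decomposition (C 4 ⊗ H)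
  C₄⊗-decomposition arcs = size , cycle , covers
    where
    open ArcEnumeration arcs

    cycle : Fin size → FourCycle (C 4 ⊗ H)
    cycle = alternatingCycle ∘ arc-edge

    covers : ∀ u v → E (C 4 ⊗ H) u v →
             Σ (Fin size) λ i → EdgeOf (cycle i) u v × (∀ j → EdgeOf (cycle j) u v → j ≡ i)
    covers (a , s) (b , t) (ab , st) = index e , inCycle , unique
      where
      e : E H (alternate a s t) (alternate a t s)
      e = alternate-edge a st

      inCycle : EdgeOf (cycle (index e)) (a , s) (b , t)
      inCycle = alternatingCycle-cong e (arc-edge (index e)) (sym (arc-index e))
                  (edgeOf-alternatingCycle a b e ab)

      unique : ∀ j → EdgeOf (cycle j) (a , s) (b , t) → j ≡ index e
      unique j c = index-arc e j (edgeOf-alternatingCycle⁻¹ (arc-edge j) c)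

K-arcs : ∀ p → ArcEnumeration (K (suc p))
K-arcs p = record
  { size      = suc p * p
  ; arc       = arcAt ∘ remQuot p
  ; arc-edge  = arcAt-edge ∘ remQuot p
  ; index     = λ {x} e → combine x (punchOut e)
  ; arc-index = λ {x} e → trans (cong arcAt (remQuot-combine x (punchOut e)))
                                (cong (x ,_) (punchIn-punchOut e))
  ; index-arc = λ e j eq → trans (sym (combine-remQuot p j)) (arcAt-index e (remQuot p j) eq)
  }
  where
  arcAt : Fin (suc p) × Fin p → Fin (suc p) × Fin (suc p)
  arcAt (x , k) = x , punchIn x k

  arcAt-edge : ∀ q → proj₁ (arcAt q) ≢ proj₂ (arcAt q)
  arcAt-edge (x , k) = ≢-sym (punchInᵢ≢i x k)

  arcAt-index : ∀ {x y} (e : x ≢ y) q → arcAt q ≡ (x , y) → uncurry combine q ≡ combine x (punchOut e)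
  arcAt-index e (x , k) refl =
    cong (combine x) (punchIn-injective x k (punchOut e) (sym (punchIn-punchOut e)))

-- The construction works for every n ≥ 1; the bound n ≥ 3 only excludes n = 0.
lemma5p1 : ∀ (n : ℕ) → n ≥ 3 → C4Decomposition (C 4 ⊗ K n)
lemma5p1 (suc p) _ = C₄⊗-decomposition ≢-sym (K-arcs p)
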